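{- Let $N=(S,A,T)$ be a P/T net with silent moves and let $R\subseteq S\times S$ be a place relation. It is decidable whether $R$ is a branching place bisimulation.
   Context: A P/T net is $N=(S,A,T)$ with $S$ a finite set of places, $A$ a finite set of labels, and $T\subseteq(\mathcal{M}(S)\setminus\{\theta\})\times A\times\mathcal{M}(S)$ a finite set of transitions, where $\mathcal{M}(S)$ is the set of finite multisets over $S$ (markings) and $\theta$ is the empty multiset. $N$ has silent moves if $\tau\in A$. For $t=(m,\ell,m')$ write ${}^\bullet t=m$, $l(t)=\ell$, $t^\bullet=m'$. $\oplus$ is multiset union, $\ominus$ truncated difference, $\subseteq$ multiset inclusion, $|m|$ size. $t$ is enabled at $m$ if ${}^\bullet t\subseteq m$; firing gives $m[t\rangle m'$ with $m'=(m\ominus{}^\bullet t)\oplus t^\bullet$; firing sequences $m[\sigma\rangle m'$ are defined inductively. For sequences: ${}^\bullet\epsilon=\theta$, ${}^\bullet(t\sigma)={}^\bullet t\oplus({}^\bullet\sigma\ominus t^\bullet)$, $\epsilon^\bullet=\theta$, $(t\sigma)^\bullet=\sigma^\bullet\oplus(t^\bullet\ominus{}^\bullet\sigma)$. $t$ is $\tau$-sequential if $l(t)=\tau$ and $|{}^\bullet t|=|t^\bullet|=1$. Idling transitions $i(s)=(s,\tau,s)$, $s\in S$, form $I(S)$ and may be used in sequences. $\sigma=t_1\dots t_n$ ($n\ge1$, $t_i\in T\cup I(S)$) is $\tau$-1-sequential if all $t_i$ have label $\tau$, $|{}^\bullet t_i|=|t_i^\bullet|=1$, and $t_i^\bullet={}^\bullet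 t_{i+1}$; $\sigma=\sigma_1\dots\sigma_k$ is $\tau$-$k$-sequential if each $\sigma_i$ is $\tau$-1-sequential, ${}^\bullet\sigma=\bigoplus_i{}^\bullet\sigma_i$, $\sigma^\bullet=\bigoplus_i\sigma_i^\bullet$; $\tau$-sequential means $\tau$-$k$-sequential for some $k\ge1$. The additive closure $R^\oplus$ of $R\subseteq S\times S$ is the least relation on markings with $(\theta,\theta)\in R^\oplus$ and closed under: $(s_1,s_2)\in R$, $(m_1,m_2)\in R^\oplus$ imply $(s_1\oplus m_1,s_2\oplus m_2)\in R^\oplus$. For $\tau$-sequential $\sigma=t_1\dots t_n$ with ${}^\bullet\sigma=m_0[t_1\rangle m_1\cdots[t_n\rangle m_n=\sigma^\bullet$: $\Psi(m,\sigma,R^\oplus)$ iff $(m,m_i)\in R^\oplus$ for $i=0,\dots,n-1$; $\Phi(\sigma,m,R^\oplus)$ iff $(m_i,m)\in R^\oplus$ for $i=0,\dots,n-1$. A branching place bisimulation is $R\subseteq S\times S$ such that whenever $(m_1,m_2)\in R^\oplus$: (1) for every $t_1$ with $m_1[t_1\rangle m_1'$, either (i) $t_1$ is $\tau$-sequential and there are $\tau$-sequential $\sigma$ and $m_2'$ with $m_2[\sigma\rangle m_2'$, $\Psi({}^\bullet t_1,\sigma,R^\oplus)$, $({}^\bullet t_1,\sigma^\bullet)\in R^\oplus$, $(t_1^\bullet,\sigma^\bullet)\in R^\oplus$, $(m_1\ominus{}^\bullet t_1,m_2\ominus{}^\bullet\sigma)\in R^\oplus$; or (ii) there are $\tau$-sequential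 $\sigma$, $t_2\in T$, $m$, $m_2'$ with $m_2[\sigma\rangle m[t_2\rangle m_2'$, $\sigma^\bullet={}^\bullet t_2$, $l(t_1)=l(t_2)$, $\Psi({}^\bullet t_1,\sigma,R^\oplus)$, $({}^\bullet t_1,\sigma^\bullet)\in R^\oplus$, $(t_1^\bullet,t_2^\bullet)\in R^\oplus$, $(m_1\ominus{}^\bullet t_1,m_2\ominus{}^\bullet\sigma)\in R^\oplus$; (2) symmetrically for every $t_2$ with $m_2[t_2\rangle m_2'$: either (i) $t_2$ is $\tau$-sequential and there are $\tau$-sequential $\sigma$, $m_1'$ with $m_1[\sigma\rangle m_1'$, $\Phi(\sigma,{}^\bullet t_2,R^\oplus)$, $(\sigma^\bullet,{}^\bullet t_2)\in R^\oplus$, $(\sigma^\bullet,t_2^\bullet)\in R^\oplus$, $(m_1\ominus{}^\bullet\sigma,m_2\ominus{}^\bullet t_2)\in R^\oplus$; or (ii) there are $\tau$-sequential $\sigma$, $t_1\in T$, $m$, $m_1'$ with $m_1[\sigma\rangle m[t_1\rangle m_1'$, $\sigma^\bullet={}^\bullet t_1$, $l(t_1)=l(t_2)$, $\Phi(\sigma,{}^\bullet t_2,R^\oplus)$, $(\sigma^\bullet,{}^\bullet t_2)\in R^\oplus$, $(t_1^\bullet,t_2^\bullet)\in R^\oplus$, $(m_1\ominus{}^\bullet\sigma,m_2\ominus{}^\bullet t_2)\in R^\oplus$. -}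

module Defs where

open import Data.Nat using (ℕ; zero; suc; _+_; _∸_; _≤_)
open import Data.Fin using (Fin)
open import Data.Fin.Properties using () renaming (_≟_ to _≟ᶠ_)
open import Data.Vec using (Vec; replicate; zipWith; tabulate; foldr)
open import Data.Vec.Relation.Binary.Pointwise.Inductive using (Pointwise)
open import Data.List using (List; []; _∷_; concat)
open import Data.List.Relation.Unary.All using (All)
open import Data.List.Membership.Propositional using (_∈_)
open import Data.Product using (Σ; _×_; _,_; ∃; ∃-syntax; proj₁; proj₂)
open import Data.Sum using (_⊎_)
open import Relation.Binary.PropositionalEquality using (_≡_; _≢_)
open import Relation.Nullary using (Dec; does)
open import Data.Bool using (if_then_else_)

-- Markings: finite multisets over the places Fin n, as vectors of
-- multiplicities.

Marking : ℕ → Set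
Marking n = Vec ℕ n

module _ {n : ℕ} where

  θ : Marking n
  θ = replicate n 0

  _⊕_ : Marking n → Marking n → Marking n
  _⊕_ = zipWith _+_

  _⊖_ : Marking n → Marking n → Marking n
  _⊖_ = zipWith _∸_

  _⊆ₘ_ : Marking n → Marking n → Set
  _⊆ₘ_ = Pointwise _≤_

  ∣_∣ : Marking n → ℕ
  ∣ m ∣ = foldr (λ _ → ℕ) _+_ 0 m

  ⟦_⟧ : Fin n → Marking n
  ⟦ s ⟧ = tabulate (λ j → if does (s ≟ᶠ j) then 1 else 0)

  ⨁ : List (Marking n) → Marking n
  ⨁ []       = θ
  ⨁ (m ∷ ms) = m ⊕ ⨁ ms

record Trans (n a : ℕ) : Set where
  constructor tr
  field
    pre  : Marking n
    lab  : Fin a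
    post : Marking n
open Trans public

-- A P/T net with silent moves: places S = Fin places, labels A = Fin labels,
-- τ ∈ A, and a finite set (list) T of transitions with nonempty presets.
record Net : Set where
  field
    places   : ℕ
    labels   : ℕ
    τ        : Fin labels
    T        : List (Trans places labels)
    T-pre≠θ  : All (λ t → pre t ≢ θ) T
open Net public

PlaceRel : ℕ → Set
PlaceRel n = List (Fin n × Fin n)

data AddClos {n : ℕ} (R : PlaceRel n) : Marking n → Marking n → Set where
  clos-θ : AddClos R θ θ
  clos-⊕ : ∀ {s₁ s₂ m₁ m₂} → (s₁ , s₂) ∈ R → AddClos R m₁ m₂ →
           AddClos R (⟦ s₁ ⟧ ⊕ m₁) (⟦ s₂ ⟧ ⊕ m₂)

module _ (N : Net) where

  private
    P = places N
    Tr = Trans P (labels N)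
    M = Marking P

  idle : Fin P → Tr
  idle s = tr ⟦ s ⟧ (τ N) ⟦ s ⟧

  InTI : Tr → Set
  InTI t = t ∈ T N ⊎ ∃[ s ] t ≡ idle s

  Enabled : Tr → M → Set
  Enabled t m = pre t ⊆ₘ m

  fire : M → Tr → M
  fire m t = (m ⊖ pre t) ⊕ post t

  Step : M → Tr → M → Set
  Step m t m' = Enabled t m × m' ≡ fire m t

  data FireSeq : M → List Tr → M → Set where
    fs-ε : ∀ {m} → FireSeq m [] m
    fs-∷ : ∀ {m m₁ m' t σ} → InTI t → Step m t m₁ → FireSeq m₁ σ m' →
           FireSeq m (t ∷ σ) m'

  preˢ : List Tr → M
  preˢ []      = θ
  preˢ (t ∷ σ) = pre t ⊕ (preˢ σ ⊖ post t)

  postˢ : List Tr → M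
  postˢ []      = θ
  postˢ (t ∷ σ) = postˢ σ ⊕ (post t ⊖ preˢ σ)

  τSeqTrans : Tr → Set
  τSeqTrans t = lab t ≡ τ N × ∣ pre t ∣ ≡ 1 × ∣ post t ∣ ≡ 1

  Chained : List Tr → Set
  Chained []          = Data.Unit.⊤ where import Data.Unit
  Chained (t ∷ [])    = Data.Unit.⊤ where import Data.Unit
  Chained (t ∷ u ∷ σ) = post t ≡ pre u × Chained (u ∷ σ)

  τ1Seq : List Tr → Set
  τ1Seq []      = Data.Empty.⊥ where import Data.Empty
  τ1Seq (t ∷ σ) = All (λ u → InTI u × τSeqTrans u) (t ∷ σ) × Chained (t ∷ σ)

  τSeq : List Tr → Set
  τSeq σ = Σ (List (List Tr)) λ σs →
             σs ≢ [] × concat σs ≡ σ × All τ1Seq σs ×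
             preˢ σ ≡ ⨁ (Data.List.map preˢ σs) ×
             postˢ σ ≡ ⨁ (Data.List.map postˢ σs)
    where import Data.List

  -- markings m₀ … m_{n-1} of •σ = m₀ [t₁⟩ m₁ ⋯ [t_n⟩ m_n = σ•
  intermediates : M → List Tr → List M
  intermediates m []      = []
  intermediates m (t ∷ σ) = m ∷ intermediates (fire m t) σ

  Ψ : PlaceRel P → M → List Tr → Set
  Ψ R m σ = All (λ mᵢ → AddClos R m mᵢ) (intermediates (preˢ σ) σ)

  Φ : PlaceRel P → List Tr → M → Set
  Φ R σ m = All (λ mᵢ → AddClos R mᵢ m) (intermediates (preˢ σ) σ)

  Clause1 : PlaceRel P → M → M → Tr → Set
  Clause1 R m₁ m₂ t₁ =
      (τSeqTrans t₁ × Σ (List Tr) λ σ → Σ M λ m₂' →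
          τSeq σ × FireSeq m₂ σ m₂' × Ψ R (pre t₁) σ ×
          AddClos R (pre t₁) (postˢ σ) × AddClos R (post t₁) (postˢ σ) ×
          AddClos R (m₁ ⊖ pre t₁) (m₂ ⊖ preˢ σ))
    ⊎ (Σ (List Tr) λ σ → Σ Tr λ t₂ → Σ M λ m → Σ M λ m₂' →
          τSeq σ × t₂ ∈ T N × FireSeq m₂ σ m × Step m t₂ m₂' ×
          postˢ σ ≡ pre t₂ × lab t₁ ≡ lab t₂ × Ψ R (pre t₁) σ ×
          AddClos R (pre t₁) (postˢ σ) × AddClos R (post t₁) (post t₂) ×
          AddClos R (m₁ ⊖ pre t₁) (m₂ ⊖ preˢ σ))

  Clause2 : PlaceRel P → M → M → Tr → Set
  Clause2 R m₁ m₂ t₂ =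
      (τSeqTrans t₂ × Σ (List Tr) λ σ → Σ M λ m₁' →
          τSeq σ × FireSeq m₁ σ m₁' × Φ R σ (pre t₂) ×
          AddClos R (postˢ σ) (pre t₂) × AddClos R (postˢ σ) (post t₂) ×
          AddClos R (m₁ ⊖ preˢ σ) (m₂ ⊖ pre t₂))
    ⊎ (Σ (List Tr) λ σ → Σ Tr λ t₁ → Σ M λ m → Σ M λ m₁' →
          τSeq σ × t₁ ∈ T N × FireSeq m₁ σ m × Step m t₁ m₁' ×
          postˢ σ ≡ pre t₁ × lab t₁ ≡ lab t₂ × Φ R σ (pre t₂) ×
          AddClos R (postˢ σ) (pre t₂) × AddClos R (post t₁) (post t₂) ×
          AddClos R (m₁ ⊖ preˢ σ) (m₂ ⊖ pre t₂))

  IsBranchingPlaceBisim : PlaceRel P → Set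
  IsBranchingPlaceBisim R =
    ∀ m₁ m₂ → AddClos R m₁ m₂ →
      (∀ t₁ m₁' → t₁ ∈ T N → Step m₁ t₁ m₁' → Clause1 R m₁ m₂ t₁) ×
      (∀ t₂ m₂' → t₂ ∈ T N → Step m₂ t₂ m₂' → Clause2 R m₁ m₂ t₂)

-- Every quantifier in the definition can be bounded. By additivity of R^⊕ the transfer clauses
-- need only be checked at the finitely many pairs •t R^⊕ q: a related pair enabling t splits as
-- (•t , q) ⊕ (m₁ ⊖ •t , r), and the clauses survive adding a related pair. A τ-sequential σ is a
-- family of τ-1-sequential chains, one per token of •σ; if a postset repeats along a chain, the
-- segment in between is a loop, and removing it keeps •σ, σ• and the reached marking while only
-- deleting intermediate markings. So the chains can be taken with distinct postsets, hence of
-- length at most |T ∪ I(S)|, and the matching sequences range over a finite list. The second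
-- clause is the first one for the converse relation.

module Submission where

open import Defs
open import Relation.Nullary using (Dec; yes; no; ¬?)

open import Data.Nat using (ℕ; zero; suc; _+_; _∸_; _≤_; _≤?_; _≟_; z≤n; s≤s)
open import Data.Nat.Properties
open import Data.Fin using (Fin; zero; suc)
open import Data.Fin.Properties using (any?) renaming (_≟_ to _≟ᶠ_)
open import Data.Vec using ([]; _∷_; tabulate)
import Data.Vec.Properties as Vec
import Data.Vec.Relation.Binary.Pointwise.Inductive as Pointwise
open Pointwise using ([]; _∷_)
open import Data.List using (List; []; _∷_; [_]; _++_; map; length; concat; filter; cartesianProductWith; allFin)
open import Data.List.Properties using (filter-notAll; ++-assoc; length-map)
open import Data.List.Relation.Unary.All as All using (All; []; _∷_)
open import Data.List.Relation.Unary.All.Properties using (¬Any⇒All¬)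
open import Data.List.Relation.Unary.Any as Any using (Any; here; there)
open import Data.List.Relation.Unary.Unique.Propositional using (Unique)
open import Data.List.Relation.Unary.AllPairs using (AllPairs; []; _∷_)
open import Data.List.Relation.Unary.AllPairs.Properties using () renaming (map⁺ to AllPairs-map⁺)
open import Data.List.Membership.Propositional using (_∈_; lose; find)
open import Data.List.Membership.Propositional.Properties
open import Data.List.Relation.Binary.Subset.Propositional using (_⊆_)
open import Data.List.Relation.Binary.Subset.Propositional.Properties using (++⁺; ∷⁺ʳ; xs⊆ys++xs; All-resp-⊇)
  renaming (map⁺ to ⊆-map⁺)
open import Data.List.Relation.Binary.Pointwise using ([]; _∷_) renaming (Pointwise to Pointwiseᴸ)
open import Relation.Binary.Definitions using (DecidableEquality)
open import Relation.Nullary.Decidable as Decidable using (_×-dec_; _⊎-dec_; _→-dec_)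
open import Function.Bundles using (_⇔_; mk⇔; Equivalence)
open import Function.Construct.Symmetry using (⇔-sym)
open import Data.Product using (Σ; _×_; _,_; ∃; ∃₂; proj₁; proj₂; swap)
open import Data.Sum using (_⊎_; inj₁; inj₂)
open import Function using (_∘_; id)
open import Algebra.Properties.CommutativeSemigroup +-commutativeSemigroup using (interchange)
open import Relation.Binary.PropositionalEquality hiding ([_])


private
  variable
    n : ℕ

[m+n]∸o≡[m∸o]+[n∸[o∸m]] : ∀ m n o → (m + n) ∸ o ≡ (m ∸ o) + (n ∸ (o ∸ m))
[m+n]∸o≡[m∸o]+[n∸[o∸m]] zero    n o       = cong (_+ (n ∸ o)) (sym (0∸n≡0 o))
[m+n]∸o≡[m∸o]+[n∸[o∸m]] (suc m) n zero    = refl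
[m+n]∸o≡[m∸o]+[n∸[o∸m]] (suc m) n (suc o) = [m+n]∸o≡[m∸o]+[n∸[o∸m]] m n o

-- The bicyclic monoid: a pair (a , b) is "consume a, then produce b".
_·_ : ℕ × ℕ → ℕ × ℕ → ℕ × ℕ
(a , b) · (c , d) = a + (c ∸ b) , d + (b ∸ c)

·-assoc : ∀ x y z → (x · y) · z ≡ x · (y · z)
·-assoc (a , b) (c , d) (e , f) = cong₂ _,_ consumed produced
  where
  open ≡-Reasoning
  consumed : a + (c ∸ b) + (e ∸ (d + (b ∸ c))) ≡ a + (c + (e ∸ d) ∸ b)
  consumed = begin
    a + (c ∸ b) + (e ∸ (d + (b ∸ c)))   ≡⟨ +-assoc a _ _ ⟩
    a + ((c ∸ b) + (e ∸ (d + (b ∸ c)))) ≡⟨ cong (λ x → a + ((c ∸ b) + x)) (∸-+-assoc e d (b ∸ c)) ⟨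
    a + ((c ∸ b) + (e ∸ d ∸ (b ∸ c)))   ≡⟨ cong (a +_) ([m+n]∸o≡[m∸o]+[n∸[o∸m]] c (e ∸ d) b) ⟨
    a + (c + (e ∸ d) ∸ b)               ∎
  produced : f + (d + (b ∸ c) ∸ e) ≡ f + (d ∸ e) + (b ∸ (c + (e ∸ d)))
  produced = begin
    f + (d + (b ∸ c) ∸ e)               ≡⟨ cong (f +_) ([m+n]∸o≡[m∸o]+[n∸[o∸m]] d (b ∸ c) e) ⟩
    f + ((d ∸ e) + (b ∸ c ∸ (e ∸ d)))   ≡⟨ +-assoc f _ _ ⟨
    f + (d ∸ e) + (b ∸ c ∸ (e ∸ d))     ≡⟨ cong (f + (d ∸ e) +_) (∸-+-assoc b c (e ∸ d)) ⟩
    f + (d ∸ e) + (b ∸ (c + (e ∸ d)))   ∎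

·-identityˡ : ∀ x → (0 , 0) · x ≡ x
·-identityˡ (c , d) = cong (c ,_) (trans (cong (d +_) (0∸n≡0 c)) (+-identityʳ d))

·-identityʳ : ∀ x → x · (0 , 0) ≡ x
·-identityʳ (a , b) = cong (_, b) (trans (cong (a +_) (0∸n≡0 b)) (+-identityʳ a))

·-match : ∀ a b c → (a , b) · (b , c) ≡ (a , c)
·-match a b c = cong₂ _,_ (trans (cong (a +_) (n∸n≡0 b)) (+-identityʳ a))
                          (trans (cong (c +_) (n∸n≡0 b)) (+-identityʳ c))


module _ {a} {A : Set a} where

  lists≤ : ℕ → List A → List (List A)
  lists≤ zero    xs = [ [] ]
  lists≤ (suc k) xs = [] ∷ cartesianProductWith _∷_ xs (lists≤ k xs)

  ∈-lists≤⁺ : ∀ {k xs ys} → All (_∈ xs) ys → length ys ≤ k → ys ∈ lists≤ k xs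
  ∈-lists≤⁺ {zero}  []           z≤n       = here refl
  ∈-lists≤⁺ {suc k} []           _         = here refl
  ∈-lists≤⁺ {suc k} (y∈xs ∷ ys⊆) (s≤s len) = there (∈-cartesianProductWith⁺ _∷_ y∈xs (∈-lists≤⁺ ys⊆ len))

  ∈-lists≤⁻ : ∀ k xs {ys} → ys ∈ lists≤ k xs → All (_∈ xs) ys
  ∈-lists≤⁻ zero    xs (here refl) = []
  ∈-lists≤⁻ (suc k) xs (here refl) = []
  ∈-lists≤⁻ (suc k) xs (there ys∈) with ∈-cartesianProductWith⁻ _∷_ xs (lists≤ k xs) ys∈
  ... | _ , _ , y∈xs , zs∈ , refl = y∈xs ∷ ∈-lists≤⁻ k xs zs∈

  AllPairs-++⁻ʳ : ∀ {r} {R : A → A → Set r} xs {ys} → AllPairs R (xs ++ ys) → AllPairs R ys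
  AllPairs-++⁻ʳ []       pairs       = pairs
  AllPairs-++⁻ʳ (x ∷ xs) (_ ∷ pairs) = AllPairs-++⁻ʳ xs pairs

  Pointwise-≢[] : ∀ {b r} {B : Set b} {R : A → B → Set r} {xs ys} → Pointwiseᴸ R xs ys → ys ≢ [] → xs ≢ []
  Pointwise-≢[] []      ys≢[] refl = ys≢[] refl
  Pointwise-≢[] (_ ∷ _) _     ()

  Unique-⊆⇒length≤ : DecidableEquality A → ∀ {xs ys} → Unique xs → xs ⊆ ys → length xs ≤ length ys
  Unique-⊆⇒length≤ _≟_ {[]}     _              _     = z≤n
  Unique-⊆⇒length≤ _≟_ {x ∷ xs} {ys} (x∉xs ∷ u) xs⊆ys = begin-strict
    length xs                  ≤⟨ Unique-⊆⇒length≤ _≟_ u xs⊆ys′ ⟩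
    length (filter ≢x? ys)     <⟨ filter-notAll ≢x? ys (Any.map (λ where refl ≢x → ≢x refl) (xs⊆ys (here refl))) ⟩
    length ys                  ∎
    where
    open ≤-Reasoning
    ≢x? = λ y → ¬? (y ≟ x)
    xs⊆ys′ : xs ⊆ filter ≢x? ys
    xs⊆ys′ y∈xs = ∈-filter⁺ ≢x? (xs⊆ys (there y∈xs)) λ where refl → All.lookup x∉xs y∈xs refl

⊕-assoc : (u v w : Marking n) → (u ⊕ v) ⊕ w ≡ u ⊕ (v ⊕ w)
⊕-assoc = Vec.zipWith-assoc +-assoc

⊕-comm : (u v : Marking n) → u ⊕ v ≡ v ⊕ u
⊕-comm = Vec.zipWith-comm +-comm

⊕-left-comm : (u v w : Marking n) → u ⊕ (v ⊕ w) ≡ v ⊕ (u ⊕ w)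
⊕-left-comm u v w = trans (sym (⊕-assoc u v w)) (trans (cong (_⊕ w) (⊕-comm u v)) (⊕-assoc v u w))

⊕-identityˡ : (u : Marking n) → θ ⊕ u ≡ u
⊕-identityˡ = Vec.zipWith-identityˡ +-identityˡ

⊖-zeroˡ : (u : Marking n) → θ ⊖ u ≡ θ
⊖-zeroˡ = Vec.zipWith-zeroˡ 0∸n≡0

⊆ₘ-refl : {u : Marking n} → u ⊆ₘ u
⊆ₘ-refl = Pointwise.refl ≤-refl

⊆ₘ-trans : {u v w : Marking n} → u ⊆ₘ v → v ⊆ₘ w → u ⊆ₘ w
⊆ₘ-trans = Pointwise.trans ≤-trans

_≟ₘ_ : DecidableEquality (Marking n)
_≟ₘ_ = Vec.≡-dec _≟_

_⊙_ : Marking n × Marking n → Marking n × Marking n → Marking n × Marking n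
(p , q) ⊙ (p′ , q′) = p ⊕ (p′ ⊖ q) , q′ ⊕ (q ⊖ p′)

private
  cons : ℕ × ℕ → Marking n × Marking n → Marking (suc n) × Marking (suc n)
  cons (a , b) (p , q) = a ∷ p , b ∷ q

⊙-assoc : (x y z : Marking n × Marking n) → (x ⊙ y) ⊙ z ≡ x ⊙ (y ⊙ z)
⊙-assoc ([] , []) ([] , []) ([] , []) = refl
⊙-assoc (a ∷ p , b ∷ q) (c ∷ p′ , d ∷ q′) (e ∷ p″ , f ∷ q″) =
  cong₂ cons (·-assoc (a , b) (c , d) (e , f)) (⊙-assoc (p , q) (p′ , q′) (p″ , q″))

⊙-identityˡ : (x : Marking n × Marking n) → (θ , θ) ⊙ x ≡ x
⊙-identityˡ ([] , []) = refl
⊙-identityˡ (a ∷ p , b ∷ q) = cong₂ cons (·-identityˡ (a , b)) (⊙-identityˡ (p , q))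

⊙-identityʳ : (x : Marking n × Marking n) → x ⊙ (θ , θ) ≡ x
⊙-identityʳ ([] , []) = refl
⊙-identityʳ (a ∷ p , b ∷ q) = cong₂ cons (·-identityʳ (a , b)) (⊙-identityʳ (p , q))

⊙-match : (p q r : Marking n) → (p , q) ⊙ (q , r) ≡ (p , r)
⊙-match [] [] [] = refl
⊙-match (a ∷ p) (b ∷ q) (c ∷ r) = cong₂ cons (·-match a b c) (⊙-match p q r)


u⊆u⊕v : (u v : Marking n) → u ⊆ₘ (u ⊕ v)
u⊆u⊕v []      []      = []
u⊆u⊕v (a ∷ u) (b ∷ v) = m≤m+n a b ∷ u⊆u⊕v u v

v⊆u⊕v : (u v : Marking n) → v ⊆ₘ (u ⊕ v)
v⊆u⊕v []      []      = []
v⊆u⊕v (a ∷ u) (b ∷ v) = m≤n+m b a ∷ v⊆u⊕v u v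

θ⊆u : (u : Marking n) → θ ⊆ₘ u
θ⊆u []      = []
θ⊆u (a ∷ u) = z≤n ∷ θ⊆u u

u⊆θ⇒u≡θ : {u : Marking n} → u ⊆ₘ θ → u ≡ θ
u⊆θ⇒u≡θ []         = refl
u⊆θ⇒u≡θ (z≤n ∷ le) = cong (0 ∷_) (u⊆θ⇒u≡θ le)

u⊆[u⊖v]⊕v : (u v : Marking n) → u ⊆ₘ ((u ⊖ v) ⊕ v)
u⊆[u⊖v]⊕v []      []      = []
u⊆[u⊖v]⊕v (a ∷ u) (b ∷ v) =
  ≤-trans (m≤n+m∸n a b) (≤-reflexive (+-comm b (a ∸ b))) ∷ u⊆[u⊖v]⊕v u v

u⊕v⊖u≡v : (u v : Marking n) → (u ⊕ v) ⊖ u ≡ v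
u⊕v⊖u≡v []      []      = refl
u⊕v⊖u≡v (a ∷ u) (b ∷ v) = cong₂ _∷_ (m+n∸m≡n a b) (u⊕v⊖u≡v u v)

u⊕v⊖v≡u : (u v : Marking n) → (u ⊕ v) ⊖ v ≡ u
u⊕v⊖v≡u []      []      = refl
u⊕v⊖v≡u (a ∷ u) (b ∷ v) = cong₂ _∷_ (m+n∸n≡m a b) (u⊕v⊖v≡u u v)

u⊕[v⊖u]≡v : {u v : Marking n} → u ⊆ₘ v → u ⊕ (v ⊖ u) ≡ v
u⊕[v⊖u]≡v []        = refl
u⊕[v⊖u]≡v (le ∷ us) = cong₂ _∷_ (m+[n∸m]≡n le) (u⊕[v⊖u]≡v us)

[u⊖v]⊕v≡u : {u v : Marking n} → v ⊆ₘ u → (u ⊖ v) ⊕ v ≡ u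
[u⊖v]⊕v≡u []        = refl
[u⊖v]⊕v≡u (le ∷ vs) = cong₂ _∷_ (m∸n+n≡m le) ([u⊖v]⊕v≡u vs)

⊕-⊖-comm : {u w : Marking n} (v : Marking n) → w ⊆ₘ u → (u ⊕ v) ⊖ w ≡ (u ⊖ w) ⊕ v
⊕-⊖-comm []      []        = refl
⊕-⊖-comm (b ∷ v) (le ∷ ws) = cong₂ _∷_ (+-∸-comm b le) (⊕-⊖-comm v ws)

u⊆v⊕w⇒u⊖v⊆w : {u v w : Marking n} → u ⊆ₘ (v ⊕ w) → (u ⊖ v) ⊆ₘ w
u⊆v⊕w⇒u⊖v⊆w {u = a ∷ _} {b ∷ _} {_ ∷ _} (le ∷ les) = m≤n+o⇒m∸n≤o a b le ∷ u⊆v⊕w⇒u⊖v⊆w les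
u⊆v⊕w⇒u⊖v⊆w {u = []} {[]} {[]} [] = []

[v⊕w]⊖u≡w⊖[u⊖v] : {u v : Marking n} (w : Marking n) → v ⊆ₘ u → (v ⊕ w) ⊖ u ≡ w ⊖ (u ⊖ v)
[v⊕w]⊖u≡w⊖[u⊖v] []      []                = refl
[v⊕w]⊖u≡w⊖[u⊖v] {u = a ∷ _} {b ∷ _} (c ∷ w) (le ∷ les) = cong₂ _∷_ eq ([v⊕w]⊖u≡w⊖[u⊖v] w les)
  where
  eq : b + c ∸ a ≡ c ∸ (a ∸ b)
  eq = trans (cong (b + c ∸_) (sym (m+[n∸m]≡n le))) ([m+n]∸[m+o]≡n∸o b c (a ∸ b))

p⊕[s⊖q]⊆m : {m p s q : Marking n} → p ⊆ₘ m → s ⊆ₘ ((m ⊖ p) ⊕ q) → (p ⊕ (s ⊖ q)) ⊆ₘ m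
p⊕[s⊖q]⊆m {m = []} {[]} {[]} {[]} [] [] = []
p⊕[s⊖q]⊆m {m = a ∷ _} {b ∷ _} {c ∷ _} {d ∷ _} (le₁ ∷ les₁) (le₂ ∷ les₂) = le ∷ p⊕[s⊖q]⊆m les₁ les₂
  where
  le : b + (c ∸ d) ≤ a
  le = begin
    b + (c ∸ d)           ≤⟨ +-monoʳ-≤ b (∸-monoˡ-≤ d le₂) ⟩
    b + (a ∸ b + d ∸ d)   ≡⟨ cong (b +_) (m+n∸n≡m (a ∸ b) d) ⟩
    b + (a ∸ b)           ≡⟨ m+[n∸m]≡n le₁ ⟩
    a                     ∎
    where open ≤-Reasoning

∣θ∣≡0 : ∣ θ {n} ∣ ≡ 0
∣θ∣≡0 {zero}  = refl
∣θ∣≡0 {suc n} = ∣θ∣≡0 {n}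

∣u⊕v∣≡∣u∣+∣v∣ : (u v : Marking n) → ∣ u ⊕ v ∣ ≡ ∣ u ∣ + ∣ v ∣
∣u⊕v∣≡∣u∣+∣v∣ []      []      = refl
∣u⊕v∣≡∣u∣+∣v∣ (a ∷ u) (b ∷ v) =
  trans (cong (a + b +_) (∣u⊕v∣≡∣u∣+∣v∣ u v)) (interchange a b ∣ u ∣ ∣ v ∣)

∣∣-mono-⊆ : {u v : Marking n} → u ⊆ₘ v → ∣ u ∣ ≤ ∣ v ∣
∣∣-mono-⊆ []        = z≤n
∣∣-mono-⊆ (le ∷ us) = +-mono-≤ le (∣∣-mono-⊆ us)

⟦zero⟧≡1∷θ : ⟦ zero {n} ⟧ ≡ 1 ∷ θ
⟦zero⟧≡1∷θ {n} = cong (1 ∷_) (zeros n)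
  where
  zeros : ∀ n → tabulate {n = n} (λ _ → 0) ≡ θ
  zeros zero    = refl
  zeros (suc n) = cong (0 ∷_) (zeros n)

∣⟦s⟧∣≡1 : (s : Fin n) → ∣ ⟦ s ⟧ ∣ ≡ 1
∣⟦s⟧∣≡1 {suc n} zero    = trans (cong ∣_∣ (⟦zero⟧≡1∷θ {n})) (cong suc (∣θ∣≡0 {n}))
∣⟦s⟧∣≡1         (suc s) = ∣⟦s⟧∣≡1 s

-- The second alternative says that p puts no token on s.
singleton-dichotomy : (s : Fin n) (p : Marking n) →
  ⟦ s ⟧ ⊆ₘ p ⊎ (∀ m → p ⊆ₘ (⟦ s ⟧ ⊕ m) → p ⊆ₘ m × (⟦ s ⟧ ⊕ m) ⊖ p ≡ ⟦ s ⟧ ⊕ (m ⊖ p))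
singleton-dichotomy {suc n} zero (suc a ∷ p) rewrite ⟦zero⟧≡1∷θ {n} = inj₁ (s≤s z≤n ∷ θ⊆u p)
singleton-dichotomy {suc n} zero (zero ∷ p)  rewrite ⟦zero⟧≡1∷θ {n} = inj₂ λ where
  (b ∷ m) (_ ∷ le) →
    z≤n ∷ subst (p ⊆ₘ_) (⊕-identityˡ m) le ,
    cong (suc b ∷_) (trans (cong (_⊖ p) (⊕-identityˡ m)) (sym (⊕-identityˡ (m ⊖ p))))
singleton-dichotomy (suc s) (a ∷ p) with singleton-dichotomy s p
... | inj₁ s∈p  = inj₁ (z≤n ∷ s∈p)
... | inj₂ s∉p = inj₂ λ where
  (b ∷ m) (le ∷ les) → let p⊆m , eq = s∉p m les in le ∷ p⊆m , cong (b ∸ a ∷_) eq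

converse : PlaceRel n → PlaceRel n
converse = map swap

module _ {n : ℕ} {R : PlaceRel n} where

  AddClos-⊕ : ∀ {a b c d} → AddClos R a b → AddClos R c d → AddClos R (a ⊕ c) (b ⊕ d)
  AddClos-⊕ {c = c} {d} clos-θ cd rewrite ⊕-identityˡ c | ⊕-identityˡ d = cd
  AddClos-⊕ {c = c} {d} (clos-⊕ {s₁} {s₂} {a} {b} s₁Rs₂ ab) cd
    rewrite ⊕-assoc ⟦ s₁ ⟧ a c | ⊕-assoc ⟦ s₂ ⟧ b d = clos-⊕ s₁Rs₂ (AddClos-⊕ ab cd)

  AddClos-⊕-⊖ : ∀ {m₁ m₂ p₁ p₂ r₁ r₂} → p₁ ⊆ₘ m₁ → p₂ ⊆ₘ m₂ →
                AddClos R (m₁ ⊖ p₁) (m₂ ⊖ p₂) → AddClos R r₁ r₂ → AddClos R ((m₁ ⊕ r₁) ⊖ p₁) ((m₂ ⊕ r₂) ⊖ p₂)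
  AddClos-⊕-⊖ {r₁ = r₁} {r₂} p₁⊆m₁ p₂⊆m₂ restR r₁Rr₂ =
    subst₂ (AddClos R) (sym (⊕-⊖-comm r₁ p₁⊆m₁)) (sym (⊕-⊖-comm r₂ p₂⊆m₂)) (AddClos-⊕ restR r₁Rr₂)

  AddClos-split : ∀ {m₁ m₂ p} → AddClos R m₁ m₂ → p ⊆ₘ m₁ →
                  ∃₂ λ q r → m₂ ≡ q ⊕ r × AddClos R p q × AddClos R (m₁ ⊖ p) r
  AddClos-split clos-θ p⊆θ rewrite u⊆θ⇒u≡θ p⊆θ =
    θ , θ , sym (⊕-identityˡ θ) , clos-θ , subst (λ u → AddClos R u θ) (sym (⊖-zeroˡ θ)) clos-θ
  AddClos-split {p = p} (clos-⊕ {s₁} {s₂} {m₁} {m₂} s₁Rs₂ m₁Rm₂) p⊆ with singleton-dichotomy s₁ p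
  ... | inj₁ s₁∈p =
    let q , r , m₂≡q⊕r , pRq , restRr = AddClos-split m₁Rm₂ (u⊆v⊕w⇒u⊖v⊆w p⊆)
    in ⟦ s₂ ⟧ ⊕ q , r ,
       trans (cong (⟦ s₂ ⟧ ⊕_) m₂≡q⊕r) (sym (⊕-assoc ⟦ s₂ ⟧ q r)) ,
       subst (λ u → AddClos R u (⟦ s₂ ⟧ ⊕ q)) (u⊕[v⊖u]≡v s₁∈p) (clos-⊕ s₁Rs₂ pRq) ,
       subst (λ u → AddClos R u r) (sym ([v⊕w]⊖u≡w⊖[u⊖v] m₁ s₁∈p)) restRr
  ... | inj₂ s₁∉p =
    let p⊆m₁ , rest≡ = s₁∉p m₁ p⊆
        q , r , m₂≡q⊕r , pRq , restRr = AddClos-split m₁Rm₂ p⊆m₁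
    in q , ⟦ s₂ ⟧ ⊕ r ,
       trans (cong (⟦ s₂ ⟧ ⊕_) m₂≡q⊕r) (⊕-left-comm ⟦ s₂ ⟧ q r) ,
       pRq ,
       subst (λ u → AddClos R u (⟦ s₂ ⟧ ⊕ r)) (sym rest≡) (clos-⊕ s₁Rs₂ restRr)

  fsts snds : List (Fin n × Fin n) → Marking n
  fsts ps = ⨁ (map (⟦_⟧ ∘ proj₁) ps)
  snds ps = ⨁ (map (⟦_⟧ ∘ proj₂) ps)

  ∣fsts∣≡length : ∀ ps → ∣ fsts ps ∣ ≡ length ps
  ∣fsts∣≡length []             = ∣θ∣≡0 {n}
  ∣fsts∣≡length ((s , _) ∷ ps) =
    trans (∣u⊕v∣≡∣u∣+∣v∣ ⟦ s ⟧ (fsts ps)) (cong₂ _+_ (∣⟦s⟧∣≡1 s) (∣fsts∣≡length ps))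

  AddClos⇒pairs : ∀ {a b} → AddClos R a b → ∃ λ ps → All (_∈ R) ps × a ≡ fsts ps × b ≡ snds ps
  AddClos⇒pairs clos-θ = [] , [] , refl , refl
  AddClos⇒pairs (clos-⊕ {s₁} {s₂} s₁Rs₂ ab) with AddClos⇒pairs ab
  ... | ps , ps⊆R , refl , refl = (s₁ , s₂) ∷ ps , s₁Rs₂ ∷ ps⊆R , refl , refl

  pairs⇒AddClos : ∀ {ps} → All (_∈ R) ps → AddClos R (fsts ps) (snds ps)
  pairs⇒AddClos []             = clos-θ
  pairs⇒AddClos (s₁Rs₂ ∷ ps⊆R) = clos-⊕ s₁Rs₂ (pairs⇒AddClos ps⊆R)

  -- A witness of a R^⊕ b is a list of ∣ a ∣ pairs from R.
  AddClos⇔ : ∀ {a b} → AddClos R a b ⇔ Any (λ ps → a ≡ fsts ps × b ≡ snds ps) (lists≤ ∣ a ∣ R)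
  AddClos⇔ {a} = mk⇔ to from
    where
    to : ∀ {b} → AddClos R a b → Any (λ ps → a ≡ fsts ps × b ≡ snds ps) (lists≤ ∣ a ∣ R)
    to ab with AddClos⇒pairs ab
    ... | ps , ps⊆R , refl , refl = lose (∈-lists≤⁺ ps⊆R (≤-reflexive (sym (∣fsts∣≡length ps)))) (refl , refl)
    from : ∀ {b} → Any (λ ps → a ≡ fsts ps × b ≡ snds ps) (lists≤ ∣ a ∣ R) → AddClos R a b
    from any with find any
    ... | ps , ps∈ , refl , refl = pairs⇒AddClos (∈-lists≤⁻ _ R ps∈)

  AddClos? : ∀ a b → Dec (AddClos R a b)
  AddClos? a b = Decidable.map (⇔-sym AddClos⇔) (Any.any? (λ ps → (a ≟ₘ fsts ps) ×-dec (b ≟ₘ snds ps)) _)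

  ∀-AddClos? : {P : Marking n → Set} → (∀ q → Dec (P q)) → ∀ m → Dec (∀ q → AddClos R m q → P q)
  ∀-AddClos? {P} P? m =
    Decidable.map (mk⇔ from to) (All.all? (λ ps → (m ≟ₘ fsts ps) →-dec P? (snds ps)) (lists≤ ∣ m ∣ R))
    where
    from : All (λ ps → m ≡ fsts ps → P (snds ps)) (lists≤ ∣ m ∣ R) → ∀ q → AddClos R m q → P q
    from all q mRq with find (Equivalence.to AddClos⇔ mRq)
    ... | ps , ps∈ , m≡ , refl = All.lookup all ps∈ m≡
    to : (∀ q → AddClos R m q → P q) → All (λ ps → m ≡ fsts ps → P (snds ps)) (lists≤ ∣ m ∣ R)
    to ∀P = All.tabulate λ {ps} ps∈ m≡ → ∀P (snds ps) (Equivalence.from AddClos⇔ (lose ps∈ (m≡ , refl)))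

  AddClos-converse : ∀ {a b} → AddClos R a b → AddClos (converse R) b a
  AddClos-converse clos-θ            = clos-θ
  AddClos-converse (clos-⊕ s₁Rs₂ ab) = clos-⊕ (∈-map⁺ swap s₁Rs₂) (AddClos-converse ab)

  AddClos-converse⁻ : ∀ {a b} → AddClos (converse R) b a → AddClos R a b
  AddClos-converse⁻ clos-θ             = clos-θ
  AddClos-converse⁻ (clos-⊕ s₂R˘s₁ ba) with ∈-map⁻ swap s₂R˘s₁
  ... | _ , s₁Rs₂ , refl = clos-⊕ s₁Rs₂ (AddClos-converse⁻ ba)

module _ (N : Net) where

  private
    Tr = Trans (places N) (labels N)
    Mk = Marking (places N)

  _≟ₜ_ : DecidableEquality Tr
  tr p ℓ q ≟ₜ tr p′ ℓ′ q′ =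
    Decidable.map′ (λ where (refl , refl , refl) → refl) (λ where refl → refl , refl , refl)
                   ((p ≟ₘ p′) ×-dec (ℓ ≟ᶠ ℓ′) ×-dec (q ≟ₘ q′))

  InTI? : ∀ t → Dec (InTI N t)
  InTI? t = Any.any? (t ≟ₜ_) (T N) ⊎-dec any? (λ s → t ≟ₜ idle N s)

  τSeqTrans? : ∀ t → Dec (τSeqTrans N t)
  τSeqTrans? t = (lab t ≟ᶠ τ N) ×-dec (∣ pre t ∣ ≟ 1) ×-dec (∣ post t ∣ ≟ 1)

  Chained? : ∀ σ → Dec (Chained N σ)
  Chained? []          = yes _
  Chained? (t ∷ [])    = yes _
  Chained? (t ∷ u ∷ σ) = (post t ≟ₘ pre u) ×-dec Chained? (u ∷ σ)

  τ1Seq? : ∀ σ → Dec (τ1Seq N σ)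
  τ1Seq? []      = no λ ()
  τ1Seq? (t ∷ σ) = All.all? (λ u → InTI? u ×-dec τSeqTrans? u) (t ∷ σ) ×-dec Chained? (t ∷ σ)

  FireSeq-++ : ∀ {m m′ m″ α β} → FireSeq N m α m′ → FireSeq N m′ β m″ → FireSeq N m (α ++ β) m″
  FireSeq-++ fs-ε              g = g
  FireSeq-++ (fs-∷ t∈ step f) g = fs-∷ t∈ step (FireSeq-++ f g)

  FireSeq-++⁻ : ∀ α {β m m″} → FireSeq N m (α ++ β) m″ → ∃ λ m′ → FireSeq N m α m′ × FireSeq N m′ β m″
  FireSeq-++⁻ []      f                  = _ , fs-ε , f
  FireSeq-++⁻ (t ∷ α) (fs-∷ t∈ step f) = let m′ , f₁ , f₂ = FireSeq-++⁻ α f in m′ , fs-∷ t∈ step f₁ , f₂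

  FireSeq-functional : ∀ {m σ m′ m″} → FireSeq N m σ m′ → FireSeq N m σ m″ → m′ ≡ m″
  FireSeq-functional fs-ε                 fs-ε                 = refl
  FireSeq-functional (fs-∷ _ (_ , refl) f) (fs-∷ _ (_ , refl) g) = FireSeq-functional f g

  FireSeq? : ∀ m σ → Dec (∃ (FireSeq N m σ))
  FireSeq? m []      = yes (m , fs-ε)
  FireSeq? m (t ∷ σ) =
    Decidable.map′ (λ (t∈ , en , m′ , f) → m′ , fs-∷ t∈ (en , refl) f)
                   (λ where (m′ , fs-∷ t∈ (en , refl) f) → t∈ , en , m′ , f)
                   (InTI? t ×-dec Pointwise.decidable _≤?_ (pre t) m ×-dec FireSeq? (fire N m t) σ)

  FireSeq-and? : ∀ {Q : Mk → Set} → (∀ m′ → Dec (Q m′)) → ∀ m σ → Dec (∃ λ m′ → FireSeq N m σ m′ × Q m′)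
  FireSeq-and? Q? m σ with FireSeq? m σ
  ... | no ¬f       = no λ (m′ , f , _) → ¬f (m′ , f)
  ... | yes (m′ , f) = Decidable.map′ (λ q → m′ , f , q)
                                      (λ (m″ , g , q) → subst _ (FireSeq-functional g f) q) (Q? m′)

  fire-⊕ : ∀ {m t} r → pre t ⊆ₘ m → fire N (m ⊕ r) t ≡ fire N m t ⊕ r
  fire-⊕ {m} {t} r en = begin
    ((m ⊕ r) ⊖ pre t) ⊕ post t   ≡⟨ cong (_⊕ post t) (⊕-⊖-comm r en) ⟩
    ((m ⊖ pre t) ⊕ r) ⊕ post t   ≡⟨ ⊕-assoc (m ⊖ pre t) r (post t) ⟩
    (m ⊖ pre t) ⊕ (r ⊕ post t)   ≡⟨ cong ((m ⊖ pre t) ⊕_) (⊕-comm r (post t)) ⟩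
    (m ⊖ pre t) ⊕ (post t ⊕ r)   ≡⟨ ⊕-assoc (m ⊖ pre t) (post t) r ⟨
    ((m ⊖ pre t) ⊕ post t) ⊕ r   ∎
    where open ≡-Reasoning

  FireSeq-⊕ : ∀ {m σ m′} → FireSeq N m σ m′ → ∀ r → FireSeq N (m ⊕ r) σ (m′ ⊕ r)
  FireSeq-⊕ fs-ε                          r = fs-ε
  FireSeq-⊕ {m} (fs-∷ {t = t} t∈ (en , refl) f) r =
    fs-∷ t∈ (⊆ₘ-trans en (u⊆u⊕v m r) , sym (fire-⊕ {t = t} r en)) (FireSeq-⊕ f r)

  FireSeq-mono : ∀ {m m₀ σ m′} → FireSeq N m σ m′ → m ⊆ₘ m₀ → ∃ (FireSeq N m₀ σ)
  FireSeq-mono {m} {m₀} {σ} {m′} f m⊆m₀ =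
    _ , subst (λ u → FireSeq N u σ (m′ ⊕ (m₀ ⊖ m))) (u⊕[v⊖u]≡v m⊆m₀) (FireSeq-⊕ f (m₀ ⊖ m))

  preˢ-⊆ : ∀ {m σ m′} → FireSeq N m σ m′ → preˢ N σ ⊆ₘ m
  preˢ-⊆ {m} fs-ε                 = θ⊆u m
  preˢ-⊆ (fs-∷ _ (en , refl) f) = p⊕[s⊖q]⊆m en (preˢ-⊆ f)

  FireSeq-from-preˢ : ∀ {m σ m′} → FireSeq N m σ m′ → ∃ (FireSeq N (preˢ N σ) σ)
  FireSeq-from-preˢ fs-ε = _ , fs-ε
  FireSeq-from-preˢ (fs-∷ {t = t} {σ} t∈ _ f) =
    let rest = preˢ N σ ⊖ post t
        m′ , f′ = FireSeq-mono (proj₂ (FireSeq-from-preˢ f)) (u⊆[u⊖v]⊕v (preˢ N σ) (post t))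
    in m′ , fs-∷ t∈ (u⊆u⊕v (pre t) rest , refl)
                    (subst (λ u → FireSeq N u σ m′) (sym (cong (_⊕ post t) (u⊕v⊖u≡v (pre t) rest))) f′)

  intermediates-++ : ∀ {m α m′} → FireSeq N m α m′ → ∀ β →
                     intermediates N m (α ++ β) ≡ intermediates N m α ++ intermediates N m′ β
  intermediates-++ fs-ε                         β = refl
  intermediates-++ {m} (fs-∷ _ (_ , refl) f) β = cong (m ∷_) (intermediates-++ f β)

  sig : List Tr → Mk × Mk
  sig σ = preˢ N σ , postˢ N σ

  sig-++ : ∀ α β → sig (α ++ β) ≡ sig α ⊙ sig β
  sig-++ []      β = sym (⊙-identityˡ (sig β))
  sig-++ (t ∷ α) β = trans (cong ((pre t , post t) ⊙_) (sig-++ α β)) (sym (⊙-assoc _ (sig α) (sig β)))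

  _≼_ : List Tr → List Tr → Set
  σ′ ≼ σ = ∀ {m m′} → FireSeq N m σ m′ → FireSeq N m σ′ m′ × intermediates N m σ′ ⊆ intermediates N m σ

  ≼-refl : ∀ {σ} → σ ≼ σ
  ≼-refl f = f , id

  ≼-trans : ∀ {σ″ σ′ σ} → σ″ ≼ σ′ → σ′ ≼ σ → σ″ ≼ σ
  ≼-trans σ″≼σ′ σ′≼σ f = let f′ , i′ = σ′≼σ f ; f″ , i″ = σ″≼σ′ f′ in f″ , i′ ∘ i″

  ≼-++ : ∀ {α′ α β′ β} → α′ ≼ α → β′ ≼ β → (α′ ++ β′) ≼ (α ++ β)
  ≼-++ {α′} {α} {β′} {β} α′≼α β′≼β f =
    let _ , fα , fβ = FireSeq-++⁻ α f
        fα′ , iα = α′≼α fα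
        fβ′ , iβ = β′≼β fβ
    in FireSeq-++ fα′ fβ′ ,
       subst₂ _⊆_ (sym (intermediates-++ fα′ β′)) (sym (intermediates-++ fα β)) (++⁺ iα iβ)

  _⊑_ : List Tr → List Tr → Set
  σ′ ⊑ σ = σ′ ≼ σ × sig σ′ ≡ sig σ

  ⊑-concat : ∀ {σs′ σs} → Pointwiseᴸ _⊑_ σs′ σs → concat σs′ ⊑ concat σs
  ⊑-concat []                                   = ≼-refl , refl
  ⊑-concat {c′ ∷ σs′} {c ∷ σs} ((c′≼c , c′≡c) ∷ rest) =
    let σs′≼σs , σs′≡σs = ⊑-concat rest
    in ≼-++ c′≼c σs′≼σs ,
       trans (sig-++ c′ (concat σs′)) (trans (cong₂ _⊙_ c′≡c σs′≡σs) (sym (sig-++ c (concat σs))))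

  Path : Mk → List Tr → Mk → Set
  Path p []      q = p ≡ q
  Path p (t ∷ σ) q = pre t ≡ p × Path (post t) σ q

  Chained⇒Path : ∀ x xs → Chained N (x ∷ xs) → ∃ (Path (pre x) (x ∷ xs))
  Chained⇒Path x []       _               = post x , refl , refl
  Chained⇒Path x (y ∷ ys) (x→y , chained) with Chained⇒Path y ys chained
  ... | q , path rewrite x→y = q , refl , path

  Path⇒Chained : ∀ {p q} x xs → Path p (x ∷ xs) q → Chained N (x ∷ xs)
  Path⇒Chained x []       _                = _
  Path⇒Chained x (y ∷ ys) (_ , y≡ , path) = sym y≡ , Path⇒Chained y ys (y≡ , path)

  Path-++ : ∀ {p r q} α {β} → Path p α r → Path r β q → Path p (α ++ β) q
  Path-++ []      refl        path = path
  Path-++ (t ∷ α) (t≡ , path) path′ = t≡ , Path-++ α path path′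

  Path-++⁻ : ∀ {p q} α {β} → Path p (α ++ β) q → ∃ λ r → Path p α r × Path r β q
  Path-++⁻ []      path        = _ , refl , path
  Path-++⁻ (t ∷ α) (t≡ , path) = let r , path₁ , path₂ = Path-++⁻ α path in r , (t≡ , path₁) , path₂

  sig-Path : ∀ {p q} x xs → Path p (x ∷ xs) q → sig (x ∷ xs) ≡ (p , q)
  sig-Path x []       (refl , refl) = ⊙-identityʳ (pre x , post x)
  sig-Path x (y ∷ ys) (refl , path) =
    trans (cong ((pre x , post x) ⊙_) (sig-Path y ys path)) (⊙-match (pre x) (post x) _)

  fire-Path : ∀ {p q m m′} σ → Path p σ q → p ⊆ₘ m → FireSeq N m σ m′ → m′ ≡ (m ⊖ p) ⊕ q
  fire-Path []      refl        p⊆m fs-ε                  = sym ([u⊖v]⊕v≡u p⊆m)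
  fire-Path (t ∷ σ) (refl , path) _ (fs-∷ {m = m} _ (_ , refl) f) =
    trans (fire-Path σ path (v⊆u⊕v (m ⊖ pre t) (post t)) f)
          (cong (_⊕ _) (u⊕v⊖v≡u (m ⊖ pre t) (post t)))

  loop-removal : ∀ x L δ → Path (post x) L (post x) → (x ∷ δ) ≼ (x ∷ L ++ δ)
  loop-removal x L δ loop (fs-∷ {m = m} x∈ (en , refl) f) with FireSeq-++⁻ L f
  ... | m′ , fL , fδ
    with trans (fire-Path L loop (v⊆u⊕v (m ⊖ pre x) (post x)) fL) ([u⊖v]⊕v≡u (v⊆u⊕v (m ⊖ pre x) (post x)))
  ... | refl rewrite intermediates-++ fL δ =
    fs-∷ x∈ (en , refl) fδ , ∷⁺ʳ m (xs⊆ys++xs _ (intermediates N m′ L))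

  PostsDistinct : List Tr → Set
  PostsDistinct = AllPairs (λ t u → post t ≢ post u)

  -- If post x reappears as post b further on, the segment from x's successor up to b is a loop; cut it out.
  shorten : ∀ {p q} x xs → Path p (x ∷ xs) q →
            ∃ λ ys → Path p (x ∷ ys) q × ys ⊆ xs × (x ∷ ys) ≼ (x ∷ xs) × PostsDistinct (x ∷ ys)
  shorten x []       path          = [] , path , id , ≼-refl , [] ∷ []
  shorten x (y ∷ ys) (x≡ , path) with shorten y ys path
  ... | zs , path′ , zs⊆ys , y∷zs≼y∷ys , distinct with Any.any? (λ u → post x ≟ₘ post u) (y ∷ zs)
  ... | no x∉ = y ∷ zs , (x≡ , path′) , ∷⁺ʳ y zs⊆ys , ≼-++ {α′ = [ x ]} ≼-refl y∷zs≼y∷ys ,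
                ¬Any⇒All¬ _ x∉ ∷ distinct
  ... | yes x∈ with find x∈
  ... | b , b∈ , x≡b with ∈-∃++ b∈
  ... | β , δ , y∷zs≡ with Path-++⁻ β (subst (λ l → Path (post x) l _) y∷zs≡ path′)
  ... | r , path-β , (b≡r , path-δ) with AllPairs-++⁻ʳ β (subst PostsDistinct y∷zs≡ distinct)
  ... | b∉δ ∷ distinct-δ =
    δ , (x≡ , subst (λ u → Path u δ _) (sym x≡b) path-δ) , δ⊆ys , x∷δ≼ ,
    subst (λ u → All (λ t → u ≢ post t) δ) (sym x≡b) b∉δ ∷ distinct-δ
    where
    δ⊆ys : δ ⊆ y ∷ ys
    δ⊆ys d∈ = ∷⁺ʳ y zs⊆ys (subst (_ ∈_) (sym y∷zs≡) (∈-++⁺ʳ β (there d∈)))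
    x∷δ≼ : (x ∷ δ) ≼ (x ∷ y ∷ ys)
    x∷δ≼ = ≼-trans (loop-removal x (β ++ [ b ]) δ (Path-++ β path-β (b≡r , sym x≡b)))
                   (subst (λ l → (x ∷ l) ≼ (x ∷ y ∷ ys)) (trans y∷zs≡ (sym (++-assoc β [ b ] δ)))
                          (≼-++ {α′ = [ x ]} ≼-refl y∷zs≼y∷ys))

  shorten-τ1 : ∀ {c} → τ1Seq N c → ∃ λ c′ → τ1Seq N c′ × PostsDistinct c′ × c′ ⊑ c
  shorten-τ1 {x ∷ xs} (τs , chained) with Chained⇒Path x xs chained
  ... | q , path with shorten x xs path
  ... | ys , path′ , ys⊆xs , x∷ys≼ , distinct =
    x ∷ ys ,
    (All.head τs ∷ All.tabulate (All.lookup (All.tail τs) ∘ ys⊆xs) , Path⇒Chained x ys path′) ,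
    distinct , x∷ys≼ , trans (sig-Path x ys path′) (sym (sig-Path x xs path))

  TI : List Tr
  TI = T N ++ map (idle N) (allFin (places N))

  InTI⇒∈TI : ∀ {t} → InTI N t → t ∈ TI
  InTI⇒∈TI (inj₁ t∈T)       = ∈-++⁺ˡ t∈T
  InTI⇒∈TI (inj₂ (s , refl)) = ∈-++⁺ʳ (T N) (∈-map⁺ (idle N) (∈-allFin s))

  τ1Seq⇒⊆TI : ∀ {c} → τ1Seq N c → All (_∈ TI) c
  τ1Seq⇒⊆TI {_ ∷ _} (τs , _) = All.map (InTI⇒∈TI ∘ proj₁) τs

  ∣preˢ∣≡1 : ∀ {c} → τ1Seq N c → ∣ preˢ N c ∣ ≡ 1
  ∣preˢ∣≡1 {x ∷ xs} (τs , chained) with Chained⇒Path x xs chained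
  ... | _ , path = trans (cong (∣_∣ ∘ proj₁) (sig-Path x xs path)) (proj₁ (proj₂ (proj₂ (All.head τs))))

  ∣⨁preˢ∣≡length : ∀ {σs} → All (τ1Seq N) σs → ∣ ⨁ (map (preˢ N) σs) ∣ ≡ length σs
  ∣⨁preˢ∣≡length {[]}    []         = ∣θ∣≡0 {places N}
  ∣⨁preˢ∣≡length {c ∷ _} (τc ∷ τs) =
    trans (∣u⊕v∣≡∣u∣+∣v∣ (preˢ N c) _) (cong₂ _+_ (∣preˢ∣≡1 τc) (∣⨁preˢ∣≡length τs))

  PostsDistinct⇒length≤ : ∀ {c} → PostsDistinct c → All (_∈ TI) c → length c ≤ length TI
  PostsDistinct⇒length≤ {c} distinct c⊆TI = begin
    length c              ≡⟨ length-map post c ⟨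
    length (map post c)   ≤⟨ Unique-⊆⇒length≤ _≟ₘ_ (AllPairs-map⁺ distinct) (⊆-map⁺ post (All.lookup c⊆TI)) ⟩
    length (map post TI)  ≡⟨ length-map post TI ⟩
    length TI             ∎
    where open ≤-Reasoning

  τDecomposition : List (List Tr) → Set
  τDecomposition σs = σs ≢ [] × All (τ1Seq N) σs ×
                      preˢ N (concat σs) ≡ ⨁ (map (preˢ N) σs) × postˢ N (concat σs) ≡ ⨁ (map (postˢ N) σs)

  τDecomposition⇒τSeq : ∀ {σs} → τDecomposition σs → τSeq N (concat σs)
  τDecomposition⇒τSeq {σs} (σs≢[] , τs , pre≡ , post≡) = σs , σs≢[] , refl , τs , pre≡ , post≡

  τDecomposition? : ∀ σs → Dec (τDecomposition σs)
  τDecomposition? σs = nonempty? σs ×-dec All.all? τ1Seq? σs ×-dec (_ ≟ₘ _) ×-dec (_ ≟ₘ _)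
    where
    nonempty? : ∀ (xs : List (List Tr)) → Dec (xs ≢ [])
    nonempty? []      = no λ []≢[] → []≢[] refl
    nonempty? (_ ∷ _) = yes λ ()

  candidates : Mk → List (List (List Tr))
  candidates m = lists≤ ∣ m ∣ (lists≤ (length TI) TI)

  ⊑-⨁ : ∀ (f : Mk × Mk → Mk) {σs′ σs} → Pointwiseᴸ _⊑_ σs′ σs → ⨁ (map (f ∘ sig) σs′) ≡ ⨁ (map (f ∘ sig) σs)
  ⊑-⨁ f []                  = refl
  ⊑-⨁ f ((_ , c′≡c) ∷ rest) = cong₂ _⊕_ (cong f c′≡c) (⊑-⨁ f rest)

  shorten-τ1s : ∀ {σs} → All (τ1Seq N) σs →
                ∃ λ σs′ → All (λ c′ → τ1Seq N c′ × PostsDistinct c′) σs′ × Pointwiseᴸ _⊑_ σs′ σs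
  shorten-τ1s []         = [] , [] , []
  shorten-τ1s (τc ∷ τs) =
    let c′ , τc′ , distinct , c′⊑c = shorten-τ1 τc
        σs′ , τs′ , σs′⊑σs = shorten-τ1s τs
    in c′ ∷ σs′ , (τc′ , distinct) ∷ τs′ , c′⊑c ∷ σs′⊑σs

  τSeq-shortcut : ∀ {m σ m′} → τSeq N σ → FireSeq N m σ m′ →
                  ∃ λ σs → σs ∈ candidates m × τDecomposition σs × concat σs ⊑ σ
  τSeq-shortcut {m} (σs , σs≢[] , refl , τs , pre≡ , post≡) f with shorten-τ1s τs
  ... | σs′ , τs′ , σs′⊑σs =
    σs′ , ∈-lists≤⁺ (All.map component∈ τs′) few , decomposition , ⊑-concat σs′⊑σs
    where
    sig≡ = proj₂ (⊑-concat σs′⊑σs)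
    τ1s′ = All.map proj₁ τs′
    decomposition : τDecomposition σs′
    decomposition =
      Pointwise-≢[] σs′⊑σs σs≢[] ,
      τ1s′ ,
      trans (cong proj₁ sig≡) (trans pre≡ (sym (⊑-⨁ proj₁ σs′⊑σs))) ,
      trans (cong proj₂ sig≡) (trans post≡ (sym (⊑-⨁ proj₂ σs′⊑σs)))
    component∈ : ∀ {c′} → τ1Seq N c′ × PostsDistinct c′ → c′ ∈ lists≤ (length TI) TI
    component∈ (τc′ , distinct) = ∈-lists≤⁺ (τ1Seq⇒⊆TI τc′) (PostsDistinct⇒length≤ distinct (τ1Seq⇒⊆TI τc′))
    few : length σs′ ≤ ∣ m ∣
    few = begin
      length σs′                     ≡⟨ ∣⨁preˢ∣≡length τ1s′ ⟨
      ∣ ⨁ (map (preˢ N) σs′) ∣       ≡⟨ cong ∣_∣ (proj₁ (proj₂ (proj₂ decomposition))) ⟨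
      ∣ preˢ N (concat σs′) ∣        ≡⟨ cong (∣_∣ ∘ proj₁) sig≡ ⟩
      ∣ preˢ N (concat σs) ∣         ≤⟨ ∣∣-mono-⊆ (preˢ-⊆ f) ⟩
      ∣ m ∣                          ∎
      where open ≤-Reasoning

  ∃τSeq : Mk → (List Tr → Mk → Set) → Set
  ∃τSeq m Q = Σ (List Tr) λ σ → Σ Mk λ m′ → τSeq N σ × FireSeq N m σ m′ × Q σ m′

  ∃τSeq? : {Q : List Tr → Mk → Set} → (∀ σ m′ → Dec (Q σ m′)) →
           (∀ {m σ σ′ m′} → FireSeq N m σ m′ → σ′ ⊑ σ → Q σ m′ → Q σ′ m′) → ∀ m → Dec (∃τSeq m Q)
  ∃τSeq? {Q} Q? Q-⊑ m = Decidable.map (mk⇔ from to) (Any.any? candidate? (candidates m))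
    where
    Candidate : List (List Tr) → Set
    Candidate σs = τDecomposition σs × ∃ λ m′ → FireSeq N m (concat σs) m′ × Q (concat σs) m′
    candidate? : ∀ σs → Dec (Candidate σs)
    candidate? σs = τDecomposition? σs ×-dec FireSeq-and? (Q? (concat σs)) m (concat σs)
    from : Any Candidate (candidates m) → ∃τSeq m Q
    from any with find any
    ... | σs , _ , decomposition , m′ , f , q = concat σs , m′ , τDecomposition⇒τSeq decomposition , f , q
    to : ∃τSeq m Q → Any Candidate (candidates m)
    to (σ , m′ , τσ , f , q) with τSeq-shortcut τσ f
    ... | σs , σs∈ , decomposition , σs⊑σ =
      lose σs∈ (decomposition , m′ , proj₁ (proj₁ σs⊑σ f) , Q-⊑ f σs⊑σ q)

  intermediates-⊑ : ∀ {m σ σ′ m′} → FireSeq N m σ m′ → σ′ ⊑ σ →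
                    intermediates N (preˢ N σ′) σ′ ⊆ intermediates N (preˢ N σ) σ
  intermediates-⊑ f (σ′≼σ , sig≡) rewrite cong proj₁ sig≡ = proj₂ (σ′≼σ (proj₂ (FireSeq-from-preˢ f)))

  Ψ-⊑ : ∀ {R m σ σ′ m′ p} → FireSeq N m σ m′ → σ′ ⊑ σ → Ψ N R p σ → Ψ N R p σ′
  Ψ-⊑ f σ′⊑σ = All-resp-⊇ (intermediates-⊑ f σ′⊑σ)

  module _ (R : PlaceRel (places N)) (m₁ m₂ : Mk) (t₁ : Tr) where

    SilentMatch : List Tr → Mk → Set
    SilentMatch σ _ = Ψ N R (pre t₁) σ × AddClos R (pre t₁) (postˢ N σ) × AddClos R (post t₁) (postˢ N σ) ×
                      AddClos R (m₁ ⊖ pre t₁) (m₂ ⊖ preˢ N σ)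

    Answers : Mk → Mk → Tr → Set
    Answers m σ• t₂ = pre t₂ ⊆ₘ m × σ• ≡ pre t₂ × lab t₁ ≡ lab t₂ × AddClos R (post t₁) (post t₂)

    MoveMatch : List Tr → Mk → Set
    MoveMatch σ m = Ψ N R (pre t₁) σ × AddClos R (pre t₁) (postˢ N σ) × AddClos R (m₁ ⊖ pre t₁) (m₂ ⊖ preˢ N σ) ×
                    Any (Answers m (postˢ N σ)) (T N)

    Clause1⇔ : Clause1 N R m₁ m₂ t₁ ⇔ ((τSeqTrans N t₁ × ∃τSeq m₂ SilentMatch) ⊎ ∃τSeq m₂ MoveMatch)
    Clause1⇔ = mk⇔ to from
      where
      to : Clause1 N R m₁ m₂ t₁ → (τSeqTrans N t₁ × ∃τSeq m₂ SilentMatch) ⊎ ∃τSeq m₂ MoveMatch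
      to (inj₁ silent) = inj₁ silent
      to (inj₂ (σ , t₂ , m , _ , τσ , t₂∈T , f , (en , _) , σ•≡ , lab≡ , ψ , pre₁Rσ• , post₁Rpost₂ , restR)) =
        inj₂ (σ , m , τσ , f , ψ , pre₁Rσ• , restR , lose t₂∈T (en , σ•≡ , lab≡ , post₁Rpost₂))
      from : (τSeqTrans N t₁ × ∃τSeq m₂ SilentMatch) ⊎ ∃τSeq m₂ MoveMatch → Clause1 N R m₁ m₂ t₁
      from (inj₁ silent) = inj₁ silent
      from (inj₂ (σ , m , τσ , f , ψ , pre₁Rσ• , restR , answer)) with find answer
      ... | t₂ , t₂∈T , en , σ•≡ , lab≡ , post₁Rpost₂ =
        inj₂ (σ , t₂ , m , fire N m t₂ , τσ , t₂∈T , f , (en , refl) , σ•≡ , lab≡ , ψ , pre₁Rσ• , post₁Rpost₂ , restR)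

    SilentMatch-⊑ : ∀ {m σ σ′ m′} → FireSeq N m σ m′ → σ′ ⊑ σ → SilentMatch σ m′ → SilentMatch σ′ m′
    SilentMatch-⊑ f σ′⊑σ@(_ , sig≡) (ψ , pre₁Rσ• , post₁Rσ• , restR) =
      Ψ-⊑ f σ′⊑σ ψ , subst (AddClos R _) (sym (cong proj₂ sig≡)) pre₁Rσ• ,
      subst (AddClos R _) (sym (cong proj₂ sig≡)) post₁Rσ• ,
      subst (λ u → AddClos R _ (m₂ ⊖ u)) (sym (cong proj₁ sig≡)) restR

    MoveMatch-⊑ : ∀ {m σ σ′ m′} → FireSeq N m σ m′ → σ′ ⊑ σ → MoveMatch σ m′ → MoveMatch σ′ m′
    MoveMatch-⊑ f σ′⊑σ@(_ , sig≡) (ψ , pre₁Rσ• , restR , answer) =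
      Ψ-⊑ f σ′⊑σ ψ , subst (AddClos R _) (sym (cong proj₂ sig≡)) pre₁Rσ• ,
      subst (λ u → AddClos R _ (m₂ ⊖ u)) (sym (cong proj₁ sig≡)) restR ,
      subst (λ u → Any (Answers _ u) (T N)) (sym (cong proj₂ sig≡)) answer

    Ψ? : ∀ σ → Dec (Ψ N R (pre t₁) σ)
    Ψ? σ = All.all? (AddClos? (pre t₁)) _

    SilentMatch? : ∀ σ m → Dec (SilentMatch σ m)
    SilentMatch? σ _ = Ψ? σ ×-dec AddClos? _ _ ×-dec AddClos? _ _ ×-dec AddClos? _ _

    MoveMatch? : ∀ σ m → Dec (MoveMatch σ m)
    MoveMatch? σ m = Ψ? σ ×-dec AddClos? _ _ ×-dec AddClos? _ _ ×-dec Any.any? answers? (T N)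
      where
      answers? : ∀ t₂ → Dec (Answers m (postˢ N σ) t₂)
      answers? t₂ = Pointwise.decidable _≤?_ (pre t₂) m ×-dec (_ ≟ₘ pre t₂) ×-dec
                    (lab t₁ ≟ᶠ lab t₂) ×-dec AddClos? _ _

    Clause1? : Dec (Clause1 N R m₁ m₂ t₁)
    Clause1? = Decidable.map (⇔-sym Clause1⇔)
      ((τSeqTrans? t₁ ×-dec ∃τSeq? SilentMatch? SilentMatch-⊑ m₂) ⊎-dec ∃τSeq? MoveMatch? MoveMatch-⊑ m₂)

  Clause1-⊕ : ∀ {R m₁ m₂ t r₁ r₂} → Clause1 N R m₁ m₂ t → pre t ⊆ₘ m₁ → AddClos R r₁ r₂ →
              Clause1 N R (m₁ ⊕ r₁) (m₂ ⊕ r₂) t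
  Clause1-⊕ {r₂ = r₂} (inj₁ (τt , σ , m₂′ , τσ , f , ψ , pre₁Rσ• , post₁Rσ• , restR)) en r₁Rr₂ =
    inj₁ (τt , σ , m₂′ ⊕ r₂ , τσ , FireSeq-⊕ f r₂ , ψ , pre₁Rσ• , post₁Rσ• , AddClos-⊕-⊖ en (preˢ-⊆ f) restR r₁Rr₂)
  Clause1-⊕ {r₂ = r₂}
    (inj₂ (σ , t₂ , m , _ , τσ , t₂∈T , f , (en₂ , _) , σ•≡ , lab≡ , ψ , pre₁Rσ• , post₁Rpost₂ , restR)) en r₁Rr₂ =
    inj₂ (σ , t₂ , m ⊕ r₂ , fire N (m ⊕ r₂) t₂ , τσ , t₂∈T , FireSeq-⊕ f r₂ , (⊆ₘ-trans en₂ (u⊆u⊕v m r₂) , refl) ,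
          σ•≡ , lab≡ , ψ , pre₁Rσ• , post₁Rpost₂ , AddClos-⊕-⊖ en (preˢ-⊆ f) restR r₁Rr₂)

  IsBranchingPlaceSim : PlaceRel (places N) → Set
  IsBranchingPlaceSim R =
    ∀ m₁ m₂ → AddClos R m₁ m₂ → ∀ t₁ m₁′ → t₁ ∈ T N → Step N m₁ t₁ m₁′ → Clause1 N R m₁ m₂ t₁

  LocalSim : PlaceRel (places N) → Set
  LocalSim R = All (λ t → ∀ q → AddClos R (pre t) q → Clause1 N R (pre t) q t) (T N)

  IsBranchingPlaceSim⇔LocalSim : ∀ {R} → IsBranchingPlaceSim R ⇔ LocalSim R
  IsBranchingPlaceSim⇔LocalSim {R} = mk⇔ to from
    where
    to : IsBranchingPlaceSim R → LocalSim R
    to sim = All.tabulate λ {t} t∈T q pre-t-Rq → sim (pre t) q pre-t-Rq t _ t∈T (⊆ₘ-refl , refl)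
    from : LocalSim R → IsBranchingPlaceSim R
    from local m₁ m₂ m₁Rm₂ t _ t∈T (en , _) with AddClos-split m₁Rm₂ en
    ... | q , r , refl , pre-t-Rq , restRr =
      subst (λ u → Clause1 N R u (q ⊕ r) t) (u⊕[v⊖u]≡v en)
            (Clause1-⊕ (All.lookup local t∈T q pre-t-Rq) ⊆ₘ-refl restRr)

  IsBranchingPlaceSim? : ∀ R → Dec (IsBranchingPlaceSim R)
  IsBranchingPlaceSim? R =
    Decidable.map (⇔-sym IsBranchingPlaceSim⇔LocalSim)
                  (All.all? (λ t → ∀-AddClos? (λ q → Clause1? R (pre t) q t) (pre t)) (T N))

  Clause2⇒Clause1 : ∀ {R m₁ m₂ t} → Clause2 N R m₁ m₂ t → Clause1 N (converse R) m₂ m₁ t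
  Clause2⇒Clause1 (inj₁ (τt , σ , m₁′ , τσ , f , φ , σ•Rpre₂ , σ•Rpost₂ , restR)) =
    inj₁ (τt , σ , m₁′ , τσ , f , All.map AddClos-converse φ ,
          AddClos-converse σ•Rpre₂ , AddClos-converse σ•Rpost₂ , AddClos-converse restR)
  Clause2⇒Clause1 (inj₂ (σ , t₁ , m , m₁′ , τσ , t₁∈T , f , step , σ•≡ , lab≡ , φ , σ•Rpre₂ , post₁Rpost₂ , restR)) =
    inj₂ (σ , t₁ , m , m₁′ , τσ , t₁∈T , f , step , σ•≡ , sym lab≡ , All.map AddClos-converse φ ,
          AddClos-converse σ•Rpre₂ , AddClos-converse post₁Rpost₂ , AddClos-converse restR)

  Clause1⇒Clause2 : ∀ {R m₁ m₂ t} → Clause1 N (converse R) m₂ m₁ t → Clause2 N R m₁ m₂ t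
  Clause1⇒Clause2 (inj₁ (τt , σ , m₁′ , τσ , f , ψ , pre₂Rσ• , post₂Rσ• , restR)) =
    inj₁ (τt , σ , m₁′ , τσ , f , All.map AddClos-converse⁻ ψ ,
          AddClos-converse⁻ pre₂Rσ• , AddClos-converse⁻ post₂Rσ• , AddClos-converse⁻ restR)
  Clause1⇒Clause2 (inj₂ (σ , t₁ , m , m₁′ , τσ , t₁∈T , f , step , σ•≡ , lab≡ , ψ , pre₂Rσ• , post₂Rpost₁ , restR)) =
    inj₂ (σ , t₁ , m , m₁′ , τσ , t₁∈T , f , step , σ•≡ , sym lab≡ , All.map AddClos-converse⁻ ψ ,
          AddClos-converse⁻ pre₂Rσ• , AddClos-converse⁻ post₂Rpost₁ , AddClos-converse⁻ restR)

  IsBranchingPlaceBisim⇔ : ∀ {R} →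
    IsBranchingPlaceBisim N R ⇔ (IsBranchingPlaceSim R × IsBranchingPlaceSim (converse R))
  IsBranchingPlaceBisim⇔ = mk⇔
    (λ bisim → (λ m₁ m₂ m₁Rm₂ → proj₁ (bisim m₁ m₂ m₁Rm₂)) ,
               (λ m₂ m₁ m₂R˘m₁ t m′ t∈T step →
                  Clause2⇒Clause1 (proj₂ (bisim m₁ m₂ (AddClos-converse⁻ m₂R˘m₁)) t m′ t∈T step)))
    (λ (sim , sim˘) m₁ m₂ m₁Rm₂ →
       sim m₁ m₂ m₁Rm₂ ,
       λ t m′ t∈T step → Clause1⇒Clause2 (sim˘ m₂ m₁ (AddClos-converse m₁Rm₂) t m′ t∈T step))

lemma5p1 : (N : Net) (R : PlaceRel (places N)) → Dec (IsBranchingPlaceBisim N R)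
lemma5p1 N R =
  Decidable.map (⇔-sym (IsBranchingPlaceBisim⇔ N))
                (IsBranchingPlaceSim? N R ×-dec IsBranchingPlaceSim? N (converse R))
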